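{- For all integers $n,k\ge 0$, $$p^{k+1}_n=\sum_{s=0}^{n}\binom{n}{s}\,p^k_s.$$
   Context: A preferential arrangement of a finite set $S$ is an ordered set partition of $S$ (a sequence of nonempty pairwise disjoint blocks with union $S$); the empty set has exactly one. Let $a(w)$ be the number of preferential arrangements of a $w$-element set ($a(0)=1$). A barred preferential arrangement of $X_n=\{1,\dots,n\}$ with $k$ bars is a sequence of $k+1$ possibly empty, pairwise disjoint sections with union $X_n$, each equipped with a preferential arrangement of its elements. A restricted section is one whose preferential arrangement has at most one block; a free section may carry any preferential arrangement. For $k\ge0$, $p^k_n$ is the number of barred preferential arrangements of $X_n$ with $k$ bars in which one fixed section is free and the other $k$ sections are restricted; equivalently $p^k_n=\sum_{w_1+\cdots+w_{k+1}=n}\frac{n!}{w_1!\cdots w_{k+1}!}a(w_{1})$ (sum over nonnegative integer solutions). -}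

module Defs where

open import Data.Nat using (ℕ; zero; suc; _+_; _*_; _∸_; _/_; NonZero; _!)
open import Data.Nat.Combinatorics using (_C_)
open import Data.Nat.Properties using (m*n≢0; _!≢0)
open import Data.List using (List; []; _∷_; map; upTo; concatMap)
open import Data.Nat.ListAction using (sum; product)

sumTo : ℕ → (ℕ → ℕ) → ℕ
sumTo n f = sum (map f (upTo (suc n)))

-- aB b m = a(m) whenever m ≤ b (structural recursion on the bound b).
-- a(w) = number of preferential arrangements (ordered set partitions) of a
-- w-element set, counted by choosing the first block, of size j ≥ 1:
--   a(0) = 1,   a(m) = Σ_{j=1}^{m} C(m,j) · a(m - j).
aB : ℕ → ℕ → ℕ
aB _ zero = 1
aB zero (suc _) = 0
aB (suc b) (suc m) = sumTo m (λ i → (suc m C suc i) * aB b (m ∸ i))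

a : ℕ → ℕ
a w = aB w w

compositions : ℕ → ℕ → List (List ℕ)
compositions zero zero = [] ∷ []
compositions zero (suc _) = []
compositions (suc m) n =
  concatMap (λ w → map (w ∷_) (compositions m (n ∸ w))) (upTo (suc n))

factProd : List ℕ → ℕ
factProd ws = product (map _! ws)

factProd≢0 : (ws : List ℕ) → NonZero (factProd ws)
factProd≢0 [] = _
factProd≢0 (w ∷ ws) = m*n≢0 (w !) (factProd ws) {{w !≢0}} {{factProd≢0 ws}}

multinomial : ℕ → List ℕ → ℕ
multinomial n ws = _/_ (n !) (factProd ws) {{factProd≢0 ws}}

aHead : List ℕ → ℕ
aHead [] = 1
aHead (w ∷ _) = a w

p : ℕ → ℕ → ℕ
p k n = sum (map (λ ws → multinomial n ws * aHead ws) (compositions (suc k) n))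

{-# OPTIONS --safe #-}
module Submission where

-- Let (f ⋆ g) n = Σ_s C(n,s) f(s) g(n-s) be the binomial convolution (the product of
-- exponential generating functions) and Q_k(r) = multinomialSum k r the sum of the
-- multinomial coefficients of the compositions of r into k parts. Splitting off the
-- first part of a composition gives p^k = a ⋆ Q_k and Q_{k+1} = 1 ⋆ Q_k. The convolution
-- is commutative and associative (by induction on n, from the Leibniz rule for the shift
-- ∂ f = f ∘ suc, which is Pascal's rule), so p^{k+1} = a ⋆ (Q_k ⋆ 1) = p^k ⋆ 1, the
-- claimed sum.

open import Defs
open import Data.Nat using (ℕ; zero; suc; _+_; _*_; _∸_; _/_; _!; _≤_; _<_; z≤n; s≤s)
open import Data.Nat.Combinatorics
  using (_C_; nCk≡n!/k![n-k]!; k![n∸k]!∣n!; k>n⇒nCk≡0; nCk+nC[k+1]≡[n+1]C[k+1])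
open import Data.Nat.Properties
  using (+-assoc; +-comm; +-identityʳ; *-identityʳ; *-zeroʳ; *-comm; *-assoc; *-distribˡ-+; ≤-refl;
         +-∸-assoc; _!*_!≢0; +-commutativeSemigroup; *-commutativeSemigroup)
open import Data.Nat.DivMod using (m/n*n≡m; m*n/n≡m)
open import Data.Nat.Tactic.RingSolver using (solve-∀)
open import Data.Nat.ListAction using (sum)
open import Data.Nat.ListAction.Properties using (sum-++)
open import Data.List using (List; []; _∷_; _++_; map; applyUpTo; upTo; concatMap)
open import Data.List.Properties using (map-++; map-∘; map-cong; map-cong-local)
open import Data.List.Relation.Unary.All as All using (All; []; _∷_)
open import Data.List.Relation.Unary.All.Properties using (concat⁺; map⁺; applyUpTo⁺₁)
open import Algebra.Properties.CommutativeSemigroup +-commutativeSemigroup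
  using (interchange; x∙yz≈y∙xz)
open import Algebra.Properties.CommutativeSemigroup *-commutativeSemigroup
  using (xy∙z≈xz∙y)
open import Function using (_∘_; id; const)
open import Relation.Binary.PropositionalEquality
open ≡-Reasoning

∑ : ℕ → (ℕ → ℕ) → ℕ
∑ zero    f = 0
∑ (suc n) f = f 0 + ∑ n (f ∘ suc)

∑-cong : ∀ n {f g : ℕ → ℕ} → (∀ {i} → i < n → f i ≡ g i) → ∑ n f ≡ ∑ n g
∑-cong zero    f≡g = refl
∑-cong (suc n) f≡g = cong₂ _+_ (f≡g (s≤s z≤n)) (∑-cong n (f≡g ∘ s≤s))

∑-distrib-+ : ∀ n (f g : ℕ → ℕ) → ∑ n (λ i → f i + g i) ≡ ∑ n f + ∑ n g
∑-distrib-+ zero    f g = refl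
∑-distrib-+ (suc n) f g = begin
  f 0 + g 0 + ∑ n (λ i → f (suc i) + g (suc i))
    ≡⟨ cong (f 0 + g 0 +_) (∑-distrib-+ n (f ∘ suc) (g ∘ suc)) ⟩
  f 0 + g 0 + (∑ n (f ∘ suc) + ∑ n (g ∘ suc))
    ≡⟨ interchange (f 0) (g 0) _ _ ⟩
  f 0 + ∑ n (f ∘ suc) + (g 0 + ∑ n (g ∘ suc)) ∎

∑-init-last : ∀ n (f : ℕ → ℕ) → ∑ (suc n) f ≡ ∑ n f + f n
∑-init-last zero    f = +-comm (f 0) 0
∑-init-last (suc n) f = begin
  f 0 + ∑ (suc n) (f ∘ suc)          ≡⟨ cong (f 0 +_) (∑-init-last n (f ∘ suc)) ⟩
  f 0 + (∑ n (f ∘ suc) + f (suc n))  ≡⟨ +-assoc (f 0) _ _ ⟨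
  f 0 + ∑ n (f ∘ suc) + f (suc n)    ∎

∑-drop-zero-last : ∀ n (f : ℕ → ℕ) → f n ≡ 0 → ∑ (suc n) f ≡ ∑ n f
∑-drop-zero-last n f fn≡0 = begin
  ∑ (suc n) f  ≡⟨ ∑-init-last n f ⟩
  ∑ n f + f n  ≡⟨ cong (∑ n f +_) fn≡0 ⟩
  ∑ n f + 0    ≡⟨ +-identityʳ (∑ n f) ⟩
  ∑ n f        ∎

sum-map-applyUpTo : ∀ n (g f : ℕ → ℕ) → sum (map f (applyUpTo g n)) ≡ ∑ n (f ∘ g)
sum-map-applyUpTo zero    g f = refl
sum-map-applyUpTo (suc n) g f = cong (f (g 0) +_) (sum-map-applyUpTo n (g ∘ suc) f)

sumTo≡∑ : ∀ n (f : ℕ → ℕ) → sumTo n f ≡ ∑ (suc n) f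
sumTo≡∑ n = sum-map-applyUpTo (suc n) id

sum-concatMap : ∀ {A B : Set} (φ : B → ℕ) (h : A → List B) (xs : List A) →
                sum (map φ (concatMap h xs)) ≡ sum (map (sum ∘ map φ ∘ h) xs)
sum-concatMap φ h []       = refl
sum-concatMap φ h (x ∷ xs) = begin
  sum (map φ (h x ++ concatMap h xs))
    ≡⟨ cong sum (map-++ φ (h x) (concatMap h xs)) ⟩
  sum (map φ (h x) ++ map φ (concatMap h xs))
    ≡⟨ sum-++ (map φ (h x)) _ ⟩
  sum (map φ (h x)) + sum (map φ (concatMap h xs))
    ≡⟨ cong (sum (map φ (h x)) +_) (sum-concatMap φ h xs) ⟩
  sum (map φ (h x)) + sum (map (sum ∘ map φ ∘ h) xs) ∎

sum-map-*ˡ : ∀ {A : Set} c (f : A → ℕ) xs → sum (map (λ x → c * f x) xs) ≡ c * sum (map f xs)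
sum-map-*ˡ c f []       = sym (*-zeroʳ c)
sum-map-*ˡ c f (x ∷ xs) = begin
  c * f x + sum (map (λ x → c * f x) xs) ≡⟨ cong (c * f x +_) (sum-map-*ˡ c f xs) ⟩
  c * f x + c * sum (map f xs)           ≡⟨ *-distribˡ-+ c (f x) _ ⟨
  c * (f x + sum (map f xs))             ∎

_⋆_ : (ℕ → ℕ) → (ℕ → ℕ) → ℕ → ℕ
(f ⋆ g) n = ∑ (suc n) (λ s → (n C s) * f s * g (n ∸ s))

infixl 7 _⋆_

∂ : (ℕ → ℕ) → ℕ → ℕ
∂ f = f ∘ suc

⋆-cong : ∀ {f f′ g g′ : ℕ → ℕ} → f ≗ f′ → g ≗ g′ → f ⋆ g ≗ f′ ⋆ g′
⋆-cong f≗f′ g≗g′ n = ∑-cong (suc n) λ {s} _ → cong₂ (λ x y → (n C s) * x * y) (f≗f′ s) (g≗g′ (n ∸ s))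

⋆-congˡ : ∀ {f f′ : ℕ → ℕ} g → f ≗ f′ → f ⋆ g ≗ f′ ⋆ g
⋆-congˡ g f≗f′ = ⋆-cong f≗f′ (λ _ → refl)

⋆-congʳ : ∀ f {g g′ : ℕ → ℕ} → g ≗ g′ → f ⋆ g ≗ f ⋆ g′
⋆-congʳ f = ⋆-cong {f} (λ _ → refl)

⋆-distribʳ-+ : ∀ f f′ g n → ((λ m → f m + f′ m) ⋆ g) n ≡ (f ⋆ g) n + (f′ ⋆ g) n
⋆-distribʳ-+ f f′ g n =
  trans (∑-cong (suc n) λ {s} _ → distrib (n C s) (f s) (f′ s) (g (n ∸ s)))
        (∑-distrib-+ (suc n) (λ s → (n C s) * f s * g (n ∸ s))
                             (λ s → (n C s) * f′ s * g (n ∸ s)))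
  where
  distrib : ∀ c x x′ y → c * (x + x′) * y ≡ c * x * y + c * x′ * y
  distrib = solve-∀

⋆-distribˡ-+ : ∀ f g g′ n → (f ⋆ (λ m → g m + g′ m)) n ≡ (f ⋆ g) n + (f ⋆ g′) n
⋆-distribˡ-+ f g g′ n =
  trans (∑-cong (suc n) λ {s} _ → *-distribˡ-+ ((n C s) * f s) (g (n ∸ s)) (g′ (n ∸ s)))
        (∑-distrib-+ (suc n) (λ s → (n C s) * f s * g (n ∸ s))
                             (λ s → (n C s) * f s * g′ (n ∸ s)))

⋆-at-zero : ∀ f g → (f ⋆ g) 0 ≡ f 0 * g 0
⋆-at-zero f g = drop-units (f 0) (g 0)
  where
  drop-units : ∀ x y → 1 * x * y + 0 ≡ x * y
  drop-units = solve-∀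

-- Pascal's rule splits (f ⋆ g) (suc n) into two sums; the second one is f ⋆ ∂ g
-- after dropping its vanishing last term C(n, n+1) and shifting the index.
⋆-leibniz : ∀ f g n → (f ⋆ g) (suc n) ≡ (∂ f ⋆ g) n + (f ⋆ ∂ g) n
⋆-leibniz f g n = begin
  1 * f 0 * g (suc n) + ∑ (suc n) (λ t → (suc n C suc t) * f (suc t) * g (n ∸ t))
    ≡⟨ cong (1 * f 0 * g (suc n) +_) (∑-cong (suc n) λ {t} _ → pascal t) ⟩
  1 * f 0 * g (suc n) + ∑ (suc n) (λ t → (n C t) * f (suc t) * g (n ∸ t) + upper t)
    ≡⟨ cong (1 * f 0 * g (suc n) +_) (∑-distrib-+ (suc n) (λ t → (n C t) * f (suc t) * g (n ∸ t)) upper) ⟩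
  1 * f 0 * g (suc n) + ((∂ f ⋆ g) n + ∑ (suc n) upper)
    ≡⟨ x∙yz≈y∙xz (1 * f 0 * g (suc n)) ((∂ f ⋆ g) n) (∑ (suc n) upper) ⟩
  (∂ f ⋆ g) n + (1 * f 0 * g (suc n) + ∑ (suc n) upper)
    ≡⟨ cong (λ x → (∂ f ⋆ g) n + (1 * f 0 * g (suc n) + x)) upper-sum ⟩
  (∂ f ⋆ g) n + (f ⋆ ∂ g) n ∎
  where
  upper : ℕ → ℕ
  upper t = (n C suc t) * f (suc t) * g (n ∸ t)

  distrib : ∀ c c′ x y → (c + c′) * x * y ≡ c * x * y + c′ * x * y
  distrib = solve-∀

  pascal : ∀ t → (suc n C suc t) * f (suc t) * g (n ∸ t) ≡ (n C t) * f (suc t) * g (n ∸ t) + upper t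
  pascal t = trans (cong (λ c → c * f (suc t) * g (n ∸ t)) (sym (nCk+nC[k+1]≡[n+1]C[k+1] n t)))
                   (distrib (n C t) (n C suc t) (f (suc t)) (g (n ∸ t)))

  upper-sum : ∑ (suc n) upper ≡ ∑ n (λ t → (n C suc t) * f (suc t) * g (suc (n ∸ suc t)))
  upper-sum = trans (∑-drop-zero-last n upper upper-last≡0)
                    (∑-cong n λ {t} t<n → cong (λ m → (n C suc t) * f (suc t) * g m) (+-∸-assoc 1 t<n))
    where
    upper-last≡0 : upper n ≡ 0
    upper-last≡0 = cong (λ c → c * f (suc n) * g (n ∸ n)) (k>n⇒nCk≡0 (≤-refl {suc n}))

⋆-comm : ∀ f g → f ⋆ g ≗ g ⋆ f
⋆-comm f g zero    = trans (⋆-at-zero f g) (trans (*-comm (f 0) (g 0)) (sym (⋆-at-zero g f)))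
⋆-comm f g (suc n) = begin
  (f ⋆ g) (suc n)               ≡⟨ ⋆-leibniz f g n ⟩
  (∂ f ⋆ g) n + (f ⋆ ∂ g) n     ≡⟨ cong₂ _+_ (⋆-comm (∂ f) g n) (⋆-comm f (∂ g) n) ⟩
  (g ⋆ ∂ f) n + (∂ g ⋆ f) n     ≡⟨ +-comm ((g ⋆ ∂ f) n) _ ⟩
  (∂ g ⋆ f) n + (g ⋆ ∂ f) n     ≡⟨ ⋆-leibniz g f n ⟨
  (g ⋆ f) (suc n)               ∎

⋆-assoc : ∀ f g h → (f ⋆ g) ⋆ h ≗ f ⋆ (g ⋆ h)
⋆-assoc f g h zero = begin
  ((f ⋆ g) ⋆ h) 0    ≡⟨ ⋆-at-zero (f ⋆ g) h ⟩
  (f ⋆ g) 0 * h 0    ≡⟨ cong (_* h 0) (⋆-at-zero f g) ⟩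
  f 0 * g 0 * h 0    ≡⟨ *-assoc (f 0) (g 0) (h 0) ⟩
  f 0 * (g 0 * h 0)  ≡⟨ cong (f 0 *_) (⋆-at-zero g h) ⟨
  f 0 * (g ⋆ h) 0    ≡⟨ ⋆-at-zero f (g ⋆ h) ⟨
  (f ⋆ (g ⋆ h)) 0    ∎
⋆-assoc f g h (suc n) = begin
  ((f ⋆ g) ⋆ h) (suc n)
    ≡⟨ ⋆-leibniz (f ⋆ g) h n ⟩
  (∂ (f ⋆ g) ⋆ h) n + (f ⋆ g ⋆ ∂ h) n
    ≡⟨ cong (_+ (f ⋆ g ⋆ ∂ h) n) (⋆-congˡ h (⋆-leibniz f g) n) ⟩
  ((λ m → (∂ f ⋆ g) m + (f ⋆ ∂ g) m) ⋆ h) n + (f ⋆ g ⋆ ∂ h) n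
    ≡⟨ cong (_+ (f ⋆ g ⋆ ∂ h) n) (⋆-distribʳ-+ (∂ f ⋆ g) (f ⋆ ∂ g) h n) ⟩
  (∂ f ⋆ g ⋆ h) n + (f ⋆ ∂ g ⋆ h) n + (f ⋆ g ⋆ ∂ h) n
    ≡⟨ cong₂ _+_ (cong₂ _+_ (⋆-assoc (∂ f) g h n) (⋆-assoc f (∂ g) h n)) (⋆-assoc f g (∂ h) n) ⟩
  (∂ f ⋆ (g ⋆ h)) n + (f ⋆ (∂ g ⋆ h)) n + (f ⋆ (g ⋆ ∂ h)) n
    ≡⟨ +-assoc ((∂ f ⋆ (g ⋆ h)) n) _ _ ⟩
  (∂ f ⋆ (g ⋆ h)) n + ((f ⋆ (∂ g ⋆ h)) n + (f ⋆ (g ⋆ ∂ h)) n)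
    ≡⟨ cong ((∂ f ⋆ (g ⋆ h)) n +_) (⋆-distribˡ-+ f (∂ g ⋆ h) (g ⋆ ∂ h) n) ⟨
  (∂ f ⋆ (g ⋆ h)) n + (f ⋆ (λ m → (∂ g ⋆ h) m + (g ⋆ ∂ h) m)) n
    ≡⟨ cong ((∂ f ⋆ (g ⋆ h)) n +_) (⋆-congʳ f (⋆-leibniz g h) n) ⟨
  (∂ f ⋆ (g ⋆ h)) n + (f ⋆ ∂ (g ⋆ h)) n
    ≡⟨ ⋆-leibniz f (g ⋆ h) n ⟨
  (f ⋆ (g ⋆ h)) (suc n) ∎

⋆-const1 : ∀ f n → (f ⋆ const 1) n ≡ sumTo n (λ s → (n C s) * f s)
⋆-const1 f n = begin
  (f ⋆ const 1) n                  ≡⟨ ∑-cong (suc n) (λ {s} _ → *-identityʳ ((n C s) * f s)) ⟩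
  ∑ (suc n) (λ s → (n C s) * f s)  ≡⟨ sumTo≡∑ n (λ s → (n C s) * f s) ⟨
  sumTo n (λ s → (n C s) * f s)    ∎

-- multinomial is defined by truncating division; on compositions the division is exact.
ExactMultinomial : ℕ → List ℕ → Set
ExactMultinomial n ws = factProd ws * multinomial n ws ≡ n !

n!≡nCk*k!*[n∸k]! : ∀ {n k} → k ≤ n → n ! ≡ (n C k) * (k ! * (n ∸ k) !)
n!≡nCk*k!*[n∸k]! {n} {k} k≤n = sym (begin
  (n C k) * (k ! * (n ∸ k) !)
    ≡⟨ cong (_* (k ! * (n ∸ k) !)) (nCk≡n!/k![n-k]! k≤n) ⟩
  _/_ (n !) (k ! * (n ∸ k) !) {{k !* (n ∸ k) !≢0}} * (k ! * (n ∸ k) !)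
    ≡⟨ m/n*n≡m {{k !* (n ∸ k) !≢0}} (k![n∸k]!∣n! k≤n) ⟩
  n ! ∎)

module _ {n w : ℕ} {ws : List ℕ} (w≤n : w ≤ n) (exact : ExactMultinomial (n ∸ w) ws) where

  private
    n!-split : n ! ≡ (n C w) * multinomial (n ∸ w) ws * factProd (w ∷ ws)
    n!-split = begin
      n !                                                     ≡⟨ n!≡nCk*k!*[n∸k]! w≤n ⟩
      (n C w) * (w ! * (n ∸ w) !)                             ≡⟨ cong (λ x → (n C w) * (w ! * x)) exact ⟨
      (n C w) * (w ! * (factProd ws * multinomial (n ∸ w) ws)) ≡⟨ rearrange (n C w) (w !) (factProd ws) _ ⟩
      (n C w) * multinomial (n ∸ w) ws * (w ! * factProd ws)  ∎
      where
      rearrange : ∀ c v x m → c * (v * (x * m)) ≡ c * m * (v * x)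
      rearrange = solve-∀

  multinomial-∷ : multinomial n (w ∷ ws) ≡ (n C w) * multinomial (n ∸ w) ws
  multinomial-∷ = trans (cong (λ x → _/_ x (factProd (w ∷ ws)) {{factProd≢0 (w ∷ ws)}}) n!-split)
                        (m*n/n≡m _ (factProd (w ∷ ws)) {{factProd≢0 (w ∷ ws)}})

  exactMultinomial-∷ : ExactMultinomial n (w ∷ ws)
  exactMultinomial-∷ = begin
    factProd (w ∷ ws) * multinomial n (w ∷ ws)                ≡⟨ cong (factProd (w ∷ ws) *_) multinomial-∷ ⟩
    factProd (w ∷ ws) * ((n C w) * multinomial (n ∸ w) ws)    ≡⟨ *-comm (factProd (w ∷ ws)) _ ⟩
    (n C w) * multinomial (n ∸ w) ws * factProd (w ∷ ws)      ≡⟨ n!-split ⟨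
    n !                                                       ∎

compositions-exact : ∀ m r → All (ExactMultinomial r) (compositions m r)
compositions-exact zero    zero    = refl ∷ []
compositions-exact zero    (suc r) = []
compositions-exact (suc m) r       = concat⁺ (map⁺ (applyUpTo⁺₁ id (suc r) exact-from))
  where
  exact-from : ∀ {w} → w < suc r → All (ExactMultinomial r) (map (w ∷_) (compositions m (r ∸ w)))
  exact-from {w} (s≤s w≤r) =
    map⁺ (All.map (λ {ws} → exactMultinomial-∷ {ws = ws} w≤r) (compositions-exact m (r ∸ w)))

sum-compositions-suc : ∀ m n (φ : List ℕ → ℕ) →
  sum (map φ (compositions (suc m) n))
    ≡ ∑ (suc n) (λ w → sum (map (φ ∘ (w ∷_)) (compositions m (n ∸ w))))
sum-compositions-suc m n φ = begin
  sum (map φ (concatMap (λ w → map (w ∷_) (compositions m (n ∸ w))) (upTo (suc n))))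
    ≡⟨ sum-concatMap φ (λ w → map (w ∷_) (compositions m (n ∸ w))) (upTo (suc n)) ⟩
  sum (map (λ w → sum (map φ (map (w ∷_) (compositions m (n ∸ w))))) (upTo (suc n)))
    ≡⟨ sum-map-applyUpTo (suc n) id _ ⟩
  ∑ (suc n) (λ w → sum (map φ (map (w ∷_) (compositions m (n ∸ w)))))
    ≡⟨ ∑-cong (suc n) (λ {w} _ → cong sum (map-∘ {g = φ} {f = w ∷_} (compositions m (n ∸ w)))) ⟨
  ∑ (suc n) (λ w → sum (map (φ ∘ (w ∷_)) (compositions m (n ∸ w)))) ∎

multinomialSum : ℕ → ℕ → ℕ
multinomialSum m r = sum (map (multinomial r) (compositions m r))

sum-compositions-headWeighted : ∀ m n (c : ℕ → ℕ) (H : List ℕ → ℕ) →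
  (∀ w ws → H (w ∷ ws) ≡ c w) →
  sum (map (λ ws → multinomial n ws * H ws) (compositions (suc m) n)) ≡ (c ⋆ multinomialSum m) n
sum-compositions-headWeighted m n c H H-head = trans (sum-compositions-suc m n _) (∑-cong (suc n) block)
  where
  block : ∀ {w} → w < suc n →
    sum (map (λ ws → multinomial n (w ∷ ws) * H (w ∷ ws)) (compositions m (n ∸ w)))
      ≡ (n C w) * c w * multinomialSum m (n ∸ w)
  block {w} (s≤s w≤n) = begin
    sum (map (λ ws → multinomial n (w ∷ ws) * H (w ∷ ws)) (compositions m (n ∸ w)))
      ≡⟨ cong sum (map-cong-local {f = λ ws → multinomial n (w ∷ ws) * H (w ∷ ws)}
                                  (All.map term (compositions-exact m (n ∸ w)))) ⟩
    sum (map (λ ws → (n C w) * c w * multinomial (n ∸ w) ws) (compositions m (n ∸ w)))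
      ≡⟨ sum-map-*ˡ ((n C w) * c w) (multinomial (n ∸ w)) (compositions m (n ∸ w)) ⟩
    (n C w) * c w * multinomialSum m (n ∸ w) ∎
    where
    term : ∀ {ws} → ExactMultinomial (n ∸ w) ws →
           multinomial n (w ∷ ws) * H (w ∷ ws) ≡ (n C w) * c w * multinomial (n ∸ w) ws
    term {ws} exact = begin
      multinomial n (w ∷ ws) * H (w ∷ ws)    ≡⟨ cong₂ _*_ (multinomial-∷ {ws = ws} w≤n exact) (H-head w ws) ⟩
      (n C w) * multinomial (n ∸ w) ws * c w ≡⟨ xy∙z≈xz∙y (n C w) _ (c w) ⟩
      (n C w) * c w * multinomial (n ∸ w) ws ∎

p≗a⋆multinomialSum : ∀ k → p k ≗ a ⋆ multinomialSum k
p≗a⋆multinomialSum k n = sum-compositions-headWeighted k n a aHead (λ _ _ → refl)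

multinomialSum-suc : ∀ k → multinomialSum (suc k) ≗ const 1 ⋆ multinomialSum k
multinomialSum-suc k r = begin
  multinomialSum (suc k) r
    ≡⟨ cong sum (map-cong (λ ws → *-identityʳ (multinomial r ws)) (compositions (suc k) r)) ⟨
  sum (map (λ ws → multinomial r ws * 1) (compositions (suc k) r))
    ≡⟨ sum-compositions-headWeighted k r (const 1) (const 1) (λ _ _ → refl) ⟩
  (const 1 ⋆ multinomialSum k) r ∎

theorem5 : (n k : ℕ) → p (suc k) n ≡ sumTo n (λ s → (n C s) * p k s)
theorem5 n k = begin
  p (suc k) n                                ≡⟨ p≗a⋆multinomialSum (suc k) n ⟩
  (a ⋆ multinomialSum (suc k)) n             ≡⟨ ⋆-congʳ a (multinomialSum-suc k) n ⟩
  (a ⋆ (const 1 ⋆ multinomialSum k)) n       ≡⟨ ⋆-congʳ a (⋆-comm (const 1) (multinomialSum k)) n ⟩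
  (a ⋆ (multinomialSum k ⋆ const 1)) n       ≡⟨ ⋆-assoc a (multinomialSum k) (const 1) n ⟨
  (a ⋆ multinomialSum k ⋆ const 1) n         ≡⟨ ⋆-congˡ (const 1) (λ s → sym (p≗a⋆multinomialSum k s)) n ⟩
  (p k ⋆ const 1) n                          ≡⟨ ⋆-const1 (p k) n ⟩
  sumTo n (λ s → (n C s) * p k s)            ∎
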